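{- Let $s,t$ be positive integers and let $G$ be an $(s,t)$-erasable graph with the maximum number of edges among all $(s,t)$-erasable graphs on $s+t+1$ vertices. Then \[ |E(G)|=\binom{s+t+1}{2}-\mathrm{wsat}(s+t+1,K_{s,t}). \]
   Context: Let $G=(V,E)$ be a graph on $s+t+1$ vertices. An edge $e\in E(G)$ is called erasable in $G$ if there is a partition $(V_1,V_2,\{v\})$ of $V$ with $|V_1|=s$, $|V_2|=t$ such that $e$ is the only edge of $G$ between $V_1$ and $V_2$ (the vertex $v$ is called closed); removing $e$ is the operation $\mathrm{Erase}(e,G)$. A graph $G$ with $m$ edges is $(s,t)$-erasable if there is an ordering $e_1,\dots,e_m$ of $E(G)$ such that for every $i\in[m]$, $e_i$ is erasable in $G\setminus\{e_1,\dots,e_{i-1}\}$ (i.e., edges can be erased one by one until no edges remain). For a fixed graph $F$, an $n$-vertex graph $H$ is weakly $F$-saturated if $H$ contains no copy of $F$ and there is an ordering $f_1,\dots,f_r$ of $E(K_n)\setminus E(H)$ such that for each $i$, $H\cup\{f_1,\dots,f_i\}$ contains a copy of $F$ containing $f_i$; $\mathrm{wsat}(n,F)$ is the minimum number of edges of a weakly $F$-saturated $n$-vertex graph. -}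

module Defs where

open import Data.Nat using (ℕ; zero; suc; _+_; _≤_; _<ᵇ_)
open import Data.Nat.Combinatorics using (_C_)
open import Data.Bool using (Bool; true; false; if_then_else_; _∧_; _∨_; not)
open import Data.Bool.Properties using (∧-comm; ∨-comm)
open import Data.Fin using (Fin; toℕ; _≟_)
open import Data.List using (List; allFin; cartesianProduct; map; length; filter)
open import Data.Nat.ListAction using (sum)
open import Data.Product using (Σ; _×_; _,_; proj₁; proj₂; ∃)
open import Data.Sum using (_⊎_; inj₁; inj₂)
open import Relation.Nullary using (¬_; does)
open import Relation.Binary.PropositionalEquality using (_≡_; _≢_; refl; cong₂; trans)
open import Function.Definitions using (Injective)

record Graph (n : ℕ) : Set where
  field
    adj   : Fin n → Fin n → Bool
    adj-sym   : ∀ i j → adj i j ≡ adj j i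
    adj-irref : ∀ i → adj i i ≡ false
open Graph public

_==_ : ∀ {n} → Fin n → Fin n → Bool
x == y = does (x ≟ y)

sameEdge : ∀ {n} → Fin n → Fin n → Fin n → Fin n → Bool
sameEdge u v x y = ((x == u) ∧ (y == v)) ∨ ((x == v) ∧ (y == u))

sameEdge-sym : ∀ {n} (u v x y : Fin n) → sameEdge u v x y ≡ sameEdge u v y x
sameEdge-sym u v x y =
  trans (cong₂ _∨_ (∧-comm (x == u) (y == v)) (∧-comm (x == v) (y == u)))
        (∨-comm ((y == v) ∧ (x == u)) ((y == u) ∧ (x == v)))

edgeCount : ∀ {n} → Graph n → ℕ
edgeCount {n} G =
  sum (map (λ p → if (toℕ (proj₁ p) <ᵇ toℕ (proj₂ p)) ∧ adj G (proj₁ p) (proj₂ p)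
                  then 1 else 0)
           (cartesianProduct (allFin n) (allFin n)))

removeEdge : ∀ {n} → Graph n → Fin n → Fin n → Graph n
removeEdge G u v = record
  { adj   = λ x y → adj G x y ∧ not (sameEdge u v x y)
  ; adj-sym   = λ x y → cong₂ (λ a b → a ∧ not b) (adj-sym G x y) (sameEdge-sym u v x y)
  ; adj-irref = λ x → cong₂ (λ a b → a ∧ not b) (adj-irref G x) refl
  }

-- G + {uv}  (u ≠ v is required by the callers; the loop is excluded anyway)
addEdge : ∀ {n} → Graph n → Fin n → Fin n → Graph n
addEdge G u v = record
  { adj   = λ x y → not (x == y) ∧ (adj G x y ∨ sameEdge u v x y)
  ; adj-sym   = λ x y → cong₂ (λ a b → not a ∧ b) (eqSym x y)
                      (cong₂ _∨_ (adj-sym G x y) (sameEdge-sym u v x y))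
  ; adj-irref = λ x → cong₂ (λ a b → not a ∧ b) (eqRefl x) refl
  }
  where
    open import Relation.Nullary.Decidable using (dec-true; dec-false)
    import Relation.Binary.PropositionalEquality as P
    eqRefl : ∀ x → (x == x) ≡ true
    eqRefl x = dec-true (x ≟ x) refl
    eqSym : ∀ x y → (x == y) ≡ (y == x)
    eqSym x y with x ≟ y | y ≟ x
    ... | Relation.Nullary.yes _ | Relation.Nullary.yes _ = refl
    ... | Relation.Nullary.no _  | Relation.Nullary.no _  = refl
    ... | Relation.Nullary.yes p | Relation.Nullary.no q  = Data.Empty.⊥-elim (q (P.sym p))
      where import Data.Empty
    ... | Relation.Nullary.no p  | Relation.Nullary.yes q = Data.Empty.⊥-elim (p (P.sym q))
      where import Data.Empty

classSize : ∀ {n} → (Fin n → Fin 3) → Fin 3 → ℕ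
classSize {n} part k = length (filter (λ x → part x ≟ k) (allFin n))

-- Class 0 = V₁, class 1 = V₂, class 2 = {closed vertex}.
ErasableEdge : (s t : ℕ) → Graph (suc (s + t)) → Fin (suc (s + t)) → Fin (suc (s + t)) → Set
ErasableEdge s t G u v =
  Σ (Fin (suc (s + t)) → Fin 3) λ part →
    classSize part Fin.zero ≡ s ×
    classSize part (Fin.suc Fin.zero) ≡ t ×
    classSize part (Fin.suc (Fin.suc Fin.zero)) ≡ 1 ×
    ((part u ≡ Fin.zero × part v ≡ Fin.suc Fin.zero) ⊎
     (part v ≡ Fin.zero × part u ≡ Fin.suc Fin.zero)) ×
    (∀ x y → part x ≡ Fin.zero → part y ≡ Fin.suc Fin.zero →
       adj G x y ≡ true → sameEdge u v x y ≡ true)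
  where import Data.Fin as Fin

data Erasable (s t : ℕ) : Graph (suc (s + t)) → Set where
  done  : ∀ {G} → (∀ i j → adj G i j ≡ false) → Erasable s t G
  erase : ∀ {G} u v → adj G u v ≡ true → ErasableEdge s t G u v →
          Erasable s t (removeEdge G u v) → Erasable s t G

record Copy {n : ℕ} (s t : ℕ) (H : Graph n) : Set where
  field
    φ     : Fin s ⊎ Fin t → Fin n
    inj   : Injective _≡_ _≡_ φ
    edges : ∀ a b → adj H (φ (inj₁ a)) (φ (inj₂ b)) ≡ true

CopyContains : ∀ {n s t} {H : Graph n} → Copy s t H → Fin n → Fin n → Set
CopyContains {s = s} {t} c u v =
  Σ (Fin s) λ a → Σ (Fin t) λ b →
    (Copy.φ c (inj₁ a) ≡ u × Copy.φ c (inj₂ b) ≡ v) ⊎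
    (Copy.φ c (inj₁ a) ≡ v × Copy.φ c (inj₂ b) ≡ u)

data Completes {n : ℕ} (s t : ℕ) : Graph n → Set where
  complete : ∀ {H} → (∀ i j → i ≢ j → adj H i j ≡ true) → Completes s t H
  add      : ∀ {H} u v → u ≢ v → adj H u v ≡ false →
             Σ (Copy s t (addEdge H u v)) (λ c → CopyContains c u v) →
             Completes s t (addEdge H u v) → Completes s t H

WeaklySat : ∀ {n} (s t : ℕ) → Graph n → Set
WeaklySat s t H = ¬ Copy s t H × Completes s t H

IsWsat : (n s t w : ℕ) → Set
IsWsat n s t w =
  Σ (Graph n) (λ H → WeaklySat s t H × edgeCount H ≡ w) ×
  (∀ (H : Graph n) → WeaklySat s t H → w ≤ edgeCount H)

{-# OPTIONS --safe #-}
-- Erasing uv from G along a partition (V₁, V₂, {w}) is the same as adding uv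
-- to the complement of G so that V₁ ∪ V₂ spans a new copy of K_{s,t} through
-- uv.  Hence G is (s,t)-erasable iff its complement H can be completed to
-- the complete graph by such additions.  For a maximum erasable G the
-- complement is then weakly K_{s,t}-saturated: a copy of K_{s,t} in H would
-- let one of its edges xy be moved to G (erased first, along that copy),
-- giving a larger erasable graph.  And H is a smallest weakly saturated
-- graph, because the complement of any weakly saturated graph is erasable,
-- hence has at most |E(G)| edges.
module Submission where

open import Defs
open import Data.Bool using (Bool; true; false; if_then_else_; _∧_; _∨_; not)
open import Data.Bool.Properties using (∧-zeroʳ; ∧-identityʳ; ∨-zeroʳ; ∨-identityʳ; not-involutive; not-injective; T-≡)
open import Data.Fin using (Fin; zero; suc; toℕ; fromℕ<; _≟_)
open import Data.Fin.Patterns using (0F; 1F; 2F)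
open import Data.Fin.Properties using (toℕ-injective; any?)
open import Data.List using (List; []; _∷_; _++_; map; tabulate; allFin; cartesianProduct; filter; length; lookup)
open import Data.List.Properties using (map-++; map-∘; map-cong)
open import Data.List.Membership.Propositional.Properties using (∈-filter⁺; ∈-filter⁻; ∈-lookup; ∈-allFin)
open import Data.List.Relation.Unary.All as All using ()
open import Data.List.Relation.Unary.AllPairs using (_∷_)
open import Data.List.Relation.Unary.Any as Any using ()
open import Data.List.Relation.Unary.Any.Properties using (lookup-index)
open import Data.List.Relation.Unary.Unique.Propositional using (Unique)
open import Data.List.Relation.Unary.Unique.Propositional.Properties using (filter⁺; allFin⁺)
open import Data.Nat using (ℕ; zero; suc; _+_; _∸_; _≤_; _<_; _<ᵇ_; z≤n; s≤s)
open import Data.Nat.Combinatorics using (_C_; nC1≡n; nCk+nC[k+1]≡[n+1]C[k+1])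
open import Data.Nat.ListAction using () renaming (sum to listSum)
open import Data.Nat.ListAction.Properties using (sum-++)
open import Data.Nat.Properties
  using (+-0-commutativeMonoid; +-mono-≤; +-mono-<-≤; +-mono-≤-<; ≤-refl; <ᵇ⇒<; <⇒<ᵇ; <⇒≢; <⇒≱; <-cmp;
         ∸-monoʳ-≤; m+n∸m≡n; +-cancelˡ-≡; +-comm; module ≤-Reasoning)
open import Algebra.Properties.CommutativeMonoid.Sum +-0-commutativeMonoid
  using (sum; sum-syntax; ∑-distrib-+; ∑-comm; sum-cong-≗; sum-replicate-zero)
open import Data.Product using (Σ; ∃; _×_; _,_; proj₁; proj₂)
open import Data.Sum using (_⊎_; inj₁; inj₂; [_,_])
open import Data.Sum.Properties using (inj₁-injective; inj₂-injective)
open import Function using (_∘_; id; Equivalence)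
open import Function.Definitions using (Injective)
open import Level using (0ℓ)
open import Relation.Binary.Definitions using (tri<; tri≈; tri>)
open import Relation.Binary.PropositionalEquality using (_≡_; _≢_; refl; sym; trans; cong; cong₂; subst; subst₂; module ≡-Reasoning)
open import Relation.Nullary using (¬_; yes; no; does; contradiction)
open import Relation.Nullary.Decidable using (dec-true; dec-false)
open import Relation.Unary using (Pred; Decidable)

indicator : Bool → ℕ
indicator b = if b then 1 else 0

indicator-mono : ∀ {b c} → (b ≡ true → c ≡ true) → indicator b ≤ indicator c
indicator-mono {false} _ = z≤n
indicator-mono {true} b⇒c rewrite b⇒c refl = ≤-refl

indicator-not : ∀ b → indicator b + indicator (not b) ≡ 1
indicator-not true = refl
indicator-not false = refl

⇒-as-∨ : ∀ {b c} → (b ≡ true → c ≡ true) → not b ∨ c ≡ true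
⇒-as-∨ {true} b⇒c = b⇒c refl
⇒-as-∨ {false} _ = refl

not-∨-as-∧ : ∀ b c → not b ∨ c ≡ not (b ∧ not c)
not-∨-as-∧ true c = sym (not-involutive c)
not-∨-as-∧ false c = refl

∑-one : ∀ n → ∑[ i < n ] 1 ≡ n
∑-one zero = refl
∑-one (suc n) = cong suc (∑-one n)

∑-zero : ∀ {n} {f : Fin n → ℕ} → (∀ i → f i ≡ 0) → sum f ≡ 0
∑-zero {n} f≗0 = trans (sum-cong-≗ f≗0) (sum-replicate-zero n)

∑-mono-≤ : ∀ {n} {f g : Fin n → ℕ} → (∀ i → f i ≤ g i) → sum f ≤ sum g
∑-mono-≤ {zero} _ = z≤n
∑-mono-≤ {suc n} f≤g = +-mono-≤ (f≤g zero) (∑-mono-≤ (f≤g ∘ suc))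

∑-mono-< : ∀ {n} {f g : Fin n → ℕ} → (∀ i → f i ≤ g i) → ∀ k → f k < g k → sum f < sum g
∑-mono-< f≤g zero fk<gk = +-mono-<-≤ fk<gk (∑-mono-≤ (f≤g ∘ suc))
∑-mono-< f≤g (suc k) fk<gk = +-mono-≤-< (f≤g zero) (∑-mono-< (f≤g ∘ suc) k fk<gk)

==-refl : ∀ {n} (i : Fin n) → (i == i) ≡ true
==-refl i = dec-true (i ≟ i) refl

==-≢ : ∀ {n} {i j : Fin n} → i ≢ j → (i == j) ≡ false
==-≢ {i = i} {j} = dec-false (i ≟ j)

==-sym : ∀ {n} (i j : Fin n) → (i == j) ≡ (j == i)
==-sym i j with i ≟ j
... | yes refl = sym (==-refl i)
... | no i≢j = sym (==-≢ (i≢j ∘ sym))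

==-injective : ∀ {k n} {f : Fin k → Fin n} → Injective _≡_ _≡_ f → ∀ a b → (f a == f b) ≡ (a == b)
==-injective {f = f} f-injective a b with a ≟ b
... | yes refl = ==-refl (f a)
... | no a≢b = ==-≢ (a≢b ∘ f-injective)

∑-indicator-== : ∀ {n} (c : Fin n) → ∑[ x < n ] indicator (x == c) ≡ 1
∑-indicator-== {suc n} zero = cong suc (∑-zero {n} λ _ → refl)
∑-indicator-== {suc n} (suc c) = ∑-indicator-== c

∑-indicator-==′ : ∀ {n} (c : Fin n) → ∑[ x < n ] indicator (c == x) ≡ 1
∑-indicator-==′ c = trans (sum-cong-≗ λ x → cong indicator (==-sym c x)) (∑-indicator-== c)

<ᵇ⇒≢ : ∀ {n} {i j : Fin n} → (toℕ i <ᵇ toℕ j) ≡ true → i ≢ j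
<ᵇ⇒≢ {i = i} {j} i<j = <⇒≢ (<ᵇ⇒< (toℕ i) (toℕ j) (Equivalence.from T-≡ i<j)) ∘ cong toℕ

listSum-map-tabulate : ∀ {n} {A : Set} (g : A → ℕ) (f : Fin n → A) →
                       listSum (map g (tabulate f)) ≡ ∑[ i < n ] g (f i)
listSum-map-tabulate {zero} g f = refl
listSum-map-tabulate {suc n} g f = cong (g (f zero) +_) (listSum-map-tabulate g (f ∘ suc))

listSum-map-cartesianProduct : ∀ {A B : Set} (g : A × B → ℕ) (xs : List A) (ys : List B) →
  listSum (map g (cartesianProduct xs ys)) ≡ listSum (map (λ x → listSum (map (λ y → g (x , y)) ys)) xs)
listSum-map-cartesianProduct g [] ys = refl
listSum-map-cartesianProduct g (x ∷ xs) ys = begin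
    listSum (map g (map (x ,_) ys ++ cartesianProduct xs ys))
  ≡⟨ cong listSum (map-++ g (map (x ,_) ys) (cartesianProduct xs ys)) ⟩
    listSum (map g (map (x ,_) ys) ++ map g (cartesianProduct xs ys))
  ≡⟨ sum-++ (map g (map (x ,_) ys)) (map g (cartesianProduct xs ys)) ⟩
    listSum (map g (map (x ,_) ys)) + listSum (map g (cartesianProduct xs ys))
  ≡⟨ cong₂ _+_ (cong listSum (sym (map-∘ ys))) (listSum-map-cartesianProduct g xs ys) ⟩
    listSum (map (λ y → g (x , y)) ys) + listSum (map (λ x → listSum (map (λ y → g (x , y)) ys)) xs) ∎
  where open ≡-Reasoning

length-filter-tabulate : ∀ {n} {A : Set} {P : Pred A 0ℓ} (P? : Decidable P) (f : Fin n → A) →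
                         length (filter P? (tabulate f)) ≡ ∑[ i < n ] indicator (does (P? (f i)))
length-filter-tabulate {zero} P? f = refl
length-filter-tabulate {suc n} P? f with does (P? (f zero))
... | true = cong suc (length-filter-tabulate P? (f ∘ suc))
... | false = length-filter-tabulate P? (f ∘ suc)

_⊆_ : ∀ {n} → Graph n → Graph n → Set
G ⊆ G′ = ∀ i j → adj G i j ≡ true → adj G′ i j ≡ true

adj⇒≢ : ∀ {n} (G : Graph n) {i j} → adj G i j ≡ true → i ≢ j
adj⇒≢ G {i} gii refl with () ← trans (sym gii) (adj-irref G i)

edgeless : ∀ {n} (G : Graph n) → (∀ {i j} → i ≢ j → adj G i j ≡ false) → ∀ i j → adj G i j ≡ false
edgeless G off i j with i ≟ j
... | yes refl = adj-irref G i
... | no i≢j = off i≢j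

sameEdge-refl : ∀ {n} (u v : Fin n) → sameEdge u v u v ≡ true
sameEdge-refl u v rewrite ==-refl u | ==-refl v = refl

sameEdge-adj : ∀ {n} (H : Graph n) {u v i j} → adj H u v ≡ true →
               sameEdge u v i j ≡ true → adj H i j ≡ true
sameEdge-adj H {u} {v} {i} {j} huv e with i ≟ u | j ≟ v | i ≟ v | j ≟ u
... | yes refl | yes refl | _ | _ = huv
... | _ | _ | yes refl | yes refl = trans (adj-sym H v u) huv
... | yes _ | no _ | yes _ | no _ with () ← e
... | yes _ | no _ | no _ | _ with () ← e
... | no _ | _ | yes _ | no _ with () ← e
... | no _ | _ | no _ | _ with () ← e

addEdge-adj : ∀ {n} (H : Graph n) (u v : Fin n) {i j} → i ≢ j →
              adj (addEdge H u v) i j ≡ adj H i j ∨ sameEdge u v i j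
addEdge-adj H u v {i} {j} i≢j = cong (λ b → not b ∧ (adj H i j ∨ sameEdge u v i j)) (==-≢ i≢j)

addEdge-adj-self : ∀ {n} (H : Graph n) {u v} → u ≢ v → adj (addEdge H u v) u v ≡ true
addEdge-adj-self H {u} {v} u≢v =
  trans (addEdge-adj H u v u≢v) (trans (cong (adj H u v ∨_) (sameEdge-refl u v)) (∨-zeroʳ (adj H u v)))

addEdge-⊇ : ∀ {n} (G : Graph n) (u v : Fin n) → G ⊆ addEdge G u v
addEdge-⊇ G u v i j gij = trans (addEdge-adj G u v (adj⇒≢ G gij)) (cong (_∨ _) gij)

removeEdge-adj-self : ∀ {n} (H : Graph n) (u v : Fin n) → adj (removeEdge H u v) u v ≡ false
removeEdge-adj-self H u v = trans (cong (λ b → adj H u v ∧ not b) (sameEdge-refl u v)) (∧-zeroʳ _)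

addEdge-removeEdge : ∀ {n} (H : Graph n) {u v} → adj H u v ≡ true →
                     ∀ i j → adj (addEdge (removeEdge H u v) u v) i j ≡ adj H i j
addEdge-removeEdge H {u} {v} huv i j with i ≟ j
... | yes refl = sym (adj-irref H i)
... | no _ with sameEdge u v i j in e
...   | true = trans (∨-zeroʳ _) (sym (sameEdge-adj H huv e))
...   | false = trans (∨-identityʳ _) (∧-identityʳ _)

copy-⊆ : ∀ {n s t} {H H′ : Graph n} → H ⊆ H′ → Copy s t H → Copy s t H′
copy-⊆ H⊆H′ c = record { φ = φ ; inj = inj ; edges = λ a b → H⊆H′ _ _ (edges a b) }
  where open Copy c

record IsComplement {n} (G H : Graph n) : Set where
  field
    adj-complement : ∀ {i j} → i ≢ j → adj H i j ≡ not (adj G i j)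
open IsComplement

complement : ∀ {n} → Graph n → Graph n
complement G = record
  { adj       = λ i j → not (i == j) ∧ not (adj G i j)
  ; adj-sym   = λ i j → cong₂ (λ e g → not e ∧ not g) (==-sym i j) (adj-sym G i j)
  ; adj-irref = λ i → cong (λ e → not e ∧ not (adj G i i)) (==-refl i)
  }

complement-isComplement : ∀ {n} (G : Graph n) → IsComplement G (complement G)
complement-isComplement G .adj-complement {i} {j} i≢j = cong (λ e → not e ∧ not (adj G i j)) (==-≢ i≢j)

isComplement-sym : ∀ {n} {G H : Graph n} → IsComplement G H → IsComplement H G
isComplement-sym comp .adj-complement i≢j =
  trans (sym (not-involutive _)) (cong not (sym (adj-complement comp i≢j)))

isComplement-removeEdge : ∀ {n} {G H : Graph n} {u v} → IsComplement G H →
                          IsComplement (removeEdge G u v) (addEdge H u v)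
isComplement-removeEdge {G = G} {H} {u} {v} comp .adj-complement {i} {j} i≢j = begin
    adj (addEdge H u v) i j            ≡⟨ addEdge-adj H u v i≢j ⟩
    adj H i j ∨ sameEdge u v i j       ≡⟨ cong (_∨ sameEdge u v i j) (adj-complement comp i≢j) ⟩
    not (adj G i j) ∨ sameEdge u v i j ≡⟨ not-∨-as-∧ (adj G i j) (sameEdge u v i j) ⟩
    not (adj (removeEdge G u v) i j)   ∎
  where open ≡-Reasoning

isComplement-addEdge : ∀ {n} {G H : Graph n} {u v} → IsComplement G H →
                       IsComplement (addEdge G u v) (removeEdge H u v)
isComplement-addEdge = isComplement-sym ∘ isComplement-removeEdge ∘ isComplement-sym

upperAdj : ∀ {n} → Graph n → Fin n → Fin n → Bool
upperAdj G i j = (toℕ i <ᵇ toℕ j) ∧ adj G i j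

edgeCount-∑ : ∀ {n} (G : Graph n) → edgeCount G ≡ ∑[ i < n ] ∑[ j < n ] indicator (upperAdj G i j)
edgeCount-∑ {n} G = begin
    edgeCount G
  ≡⟨ listSum-map-cartesianProduct (λ p → indicator (upperAdj G (proj₁ p) (proj₂ p))) (allFin n) (allFin n) ⟩
    listSum (map (λ i → listSum (map (λ j → indicator (upperAdj G i j)) (allFin n))) (allFin n))
  ≡⟨ cong listSum (map-cong (λ i → listSum-map-tabulate (λ j → indicator (upperAdj G i j)) id) (allFin n)) ⟩
    listSum (map (λ i → ∑[ j < n ] indicator (upperAdj G i j)) (allFin n))
  ≡⟨ listSum-map-tabulate (λ i → ∑[ j < n ] indicator (upperAdj G i j)) id ⟩
    ∑[ i < n ] ∑[ j < n ] indicator (upperAdj G i j) ∎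
  where open ≡-Reasoning

-- Row 0 has n entries; the remaining rows are definitionally the triangle of Fin n.
∑-pairs : ∀ n → ∑[ i < n ] ∑[ j < n ] indicator (toℕ i <ᵇ toℕ j) ≡ n C 2
∑-pairs zero = refl
∑-pairs (suc n) = begin
    ∑[ j < n ] 1 + ∑[ i < n ] ∑[ j < n ] indicator (toℕ i <ᵇ toℕ j)
  ≡⟨ cong₂ _+_ (trans (∑-one n) (sym (nC1≡n n))) (∑-pairs n) ⟩
    n C 1 + n C 2
  ≡⟨ nCk+nC[k+1]≡[n+1]C[k+1] n 1 ⟩
    suc n C 2 ∎
  where open ≡-Reasoning

edgeCount-complement : ∀ {n} {G H : Graph n} → IsComplement G H → edgeCount G + edgeCount H ≡ n C 2
edgeCount-complement {n} {G} {H} comp = begin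
    edgeCount G + edgeCount H
  ≡⟨ cong₂ _+_ (edgeCount-∑ G) (edgeCount-∑ H) ⟩
    ∑[ i < n ] ∑[ j < n ] indicator (upperAdj G i j) + ∑[ i < n ] ∑[ j < n ] indicator (upperAdj H i j)
  ≡⟨ sym (∑-distrib-+ (rowCount G) (rowCount H)) ⟩
    ∑[ i < n ] (rowCount G i + rowCount H i)
  ≡⟨ sum-cong-≗ (λ i → sym (∑-distrib-+ (indicator ∘ upperAdj G i) (indicator ∘ upperAdj H i))) ⟩
    ∑[ i < n ] ∑[ j < n ] (indicator (upperAdj G i j) + indicator (upperAdj H i j))
  ≡⟨ sum-cong-≗ {n} (λ i → sum-cong-≗ {n} (upperAdj-partition i)) ⟩
    ∑[ i < n ] ∑[ j < n ] indicator (toℕ i <ᵇ toℕ j)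
  ≡⟨ ∑-pairs n ⟩
    n C 2 ∎
  where
    open ≡-Reasoning
    rowCount : Graph n → Fin n → ℕ
    rowCount K i = ∑[ j < n ] indicator (upperAdj K i j)
    upperAdj-partition : ∀ i j → indicator (upperAdj G i j) + indicator (upperAdj H i j)
                                 ≡ indicator (toℕ i <ᵇ toℕ j)
    upperAdj-partition i j with toℕ i <ᵇ toℕ j in i<j
    ... | false = refl
    ... | true = trans (cong (λ h → indicator (adj G i j) + indicator h) (adj-complement comp (<ᵇ⇒≢ i<j)))
                       (indicator-not (adj G i j))

isComplement⇒edgeCount : ∀ {n} {G H : Graph n} → IsComplement G H → edgeCount H ≡ n C 2 ∸ edgeCount G
isComplement⇒edgeCount {G = G} {H} comp =
  trans (sym (m+n∸m≡n (edgeCount G) (edgeCount H))) (cong (_∸ edgeCount G) (edgeCount-complement comp))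

edgeCount-<-upper : ∀ {n} (G G′ : Graph n) → G ⊆ G′ → ∀ {x y} → toℕ x < toℕ y →
                    adj G x y ≡ false → adj G′ x y ≡ true → edgeCount G < edgeCount G′
edgeCount-<-upper G G′ G⊆G′ {x} {y} x<y gxy g′xy =
  subst₂ _<_ (sym (edgeCount-∑ G)) (sym (edgeCount-∑ G′))
    (∑-mono-< (λ i → ∑-mono-≤ (upperAdj-mono i)) x (∑-mono-< (upperAdj-mono x) y new-edge))
  where
    upperAdj-mono : ∀ i j → indicator (upperAdj G i j) ≤ indicator (upperAdj G′ i j)
    upperAdj-mono i j with toℕ i <ᵇ toℕ j
    ... | false = z≤n
    ... | true = indicator-mono (G⊆G′ i j)
    new-edge : indicator (upperAdj G x y) < indicator (upperAdj G′ x y)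
    new-edge rewrite Equivalence.to T-≡ (<⇒<ᵇ x<y) | gxy | g′xy = s≤s z≤n

edgeCount-< : ∀ {n} (G G′ : Graph n) → G ⊆ G′ → ∀ x y →
              adj G x y ≡ false → adj G′ x y ≡ true → edgeCount G < edgeCount G′
edgeCount-< G G′ G⊆G′ x y gxy g′xy with <-cmp (toℕ x) (toℕ y)
... | tri< x<y _ _ = edgeCount-<-upper G G′ G⊆G′ x<y gxy g′xy
... | tri≈ _ x≡y _ = contradiction (toℕ-injective x≡y) (adj⇒≢ G′ g′xy)
... | tri> _ _ y<x =
  edgeCount-<-upper G G′ G⊆G′ y<x (trans (adj-sym G y x) gxy) (trans (adj-sym G′ y x) g′xy)

record Enumeration {n} (P : Pred (Fin n) 0ℓ) (k : ℕ) : Set where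
  field
    index      : Fin k → Fin n
    injective  : Injective _≡_ _≡_ index
    sound      : ∀ a → P (index a)
    exhaustive : ∀ {x} → P x → ∃ λ a → index a ≡ x

Unique⇒lookup-injective : ∀ {A : Set} {xs : List A} → Unique xs → Injective _≡_ _≡_ (lookup xs)
Unique⇒lookup-injective (_ ∷ _) {zero} {zero} _ = refl
Unique⇒lookup-injective (x∉xs ∷ _) {zero} {suc j} e = contradiction e (All.lookup x∉xs (∈-lookup j))
Unique⇒lookup-injective (x∉xs ∷ _) {suc i} {zero} e = contradiction (sym e) (All.lookup x∉xs (∈-lookup i))
Unique⇒lookup-injective (_ ∷ unique) {suc i} {suc j} e = cong suc (Unique⇒lookup-injective unique e)

enumerate : ∀ {n k} {P : Pred (Fin n) 0ℓ} (P? : Decidable P) →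
            length (filter P? (allFin n)) ≡ k → Enumeration P k
enumerate {n} P? refl = record
  { index      = lookup members
  ; injective  = Unique⇒lookup-injective (filter⁺ P? (allFin⁺ n))
  ; sound      = λ a → proj₂ (∈-filter⁻ P? {xs = allFin n} (∈-lookup a))
  ; exhaustive = λ {x} Px → let x∈members = ∈-filter⁺ P? (∈-allFin x) Px
                            in Any.index x∈members , sym (lookup-index x∈members)
  }
  where members = filter P? (allFin n)

enumeration-length : ∀ {n k} {P : Pred (Fin n) 0ℓ} → Enumeration P k →
                     (P? : Decidable P) → length (filter P? (allFin n)) ≡ k
enumeration-length {n} {k} E P? = begin
    length (filter P? (allFin n))
  ≡⟨ length-filter-tabulate P? id ⟩
    ∑[ x < n ] indicator (does (P? x))
  ≡⟨ sum-cong-≗ fibre ⟩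
    ∑[ x < n ] ∑[ a < k ] indicator (x == index a)
  ≡⟨ ∑-comm (λ x a → indicator (x == index a)) ⟩
    ∑[ a < k ] ∑[ x < n ] indicator (x == index a)
  ≡⟨ sum-cong-≗ (λ a → ∑-indicator-== (index a)) ⟩
    ∑[ a < k ] 1
  ≡⟨ ∑-one k ⟩
    k ∎
  where
    open ≡-Reasoning
    open Enumeration E
    fibre : ∀ x → indicator (does (P? x)) ≡ ∑[ a < k ] indicator (x == index a)
    fibre x with P? x
    ... | no ¬Px =
      sym (∑-zero {k} λ a → cong indicator (dec-false (x ≟ index a) λ { refl → ¬Px (sound a) }))
    ... | yes Px with exhaustive Px
    ...   | a₀ , refl = sym (trans (sum-cong-≗ λ a → cong indicator (==-injective injective a₀ a))
                                   (∑-indicator-==′ a₀))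

classSize-total : ∀ {n} (part : Fin n → Fin 3) → classSize part 0F + classSize part 1F + classSize part 2F ≡ n
classSize-total {n} part = begin
    classSize part 0F + classSize part 1F + classSize part 2F
  ≡⟨ cong₂ _+_ (cong₂ _+_ (classSize-∑ 0F) (classSize-∑ 1F)) (classSize-∑ 2F) ⟩
    sum (member 0F) + sum (member 1F) + sum (member 2F)
  ≡⟨ sym (trans (∑-distrib-+ _ (member 2F)) (cong (_+ sum (member 2F)) (∑-distrib-+ (member 0F) (member 1F)))) ⟩
    ∑[ x < n ] (member 0F x + member 1F x + member 2F x)
  ≡⟨ sum-cong-≗ (λ x → in-one-class (part x)) ⟩
    ∑[ x < n ] 1
  ≡⟨ ∑-one n ⟩
    n ∎
  where
    open ≡-Reasoning
    member : Fin 3 → Fin n → ℕ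
    member k x = indicator (part x == k)
    classSize-∑ : ∀ k → classSize part k ≡ sum (member k)
    classSize-∑ k = length-filter-tabulate (λ x → part x ≟ k) id
    in-one-class : ∀ c → indicator (c == 0F) + indicator (c == 1F) + indicator (c == 2F) ≡ 1
    in-one-class 0F = refl
    in-one-class 1F = refl
    in-one-class 2F = refl

-- Erasable edges of G are the edges of new copies of K_{s,t} in the complement

module CopyPartition {s t} (φ : Fin s ⊎ Fin t → Fin (suc (s + t))) (φ-injective : Injective _≡_ _≡_ φ) where

  φ-disjoint : ∀ a b → φ (inj₁ a) ≢ φ (inj₂ b)
  φ-disjoint a b e with () ← φ-injective e

  side : Fin (suc (s + t)) → Fin 3
  side x with any? (λ a → φ (inj₁ a) ≟ x) | any? (λ b → φ (inj₂ b) ≟ x)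
  ... | yes _ | _     = 0F
  ... | no _  | yes _ = 1F
  ... | no _  | no _  = 2F

  side-inj₁ : ∀ a → side (φ (inj₁ a)) ≡ 0F
  side-inj₁ a with any? (λ a′ → φ (inj₁ a′) ≟ φ (inj₁ a)) | any? (λ b → φ (inj₂ b) ≟ φ (inj₁ a))
  ... | yes _ | _ = refl
  ... | no ∉V₁ | _ = contradiction (a , refl) ∉V₁

  side-inj₂ : ∀ b → side (φ (inj₂ b)) ≡ 1F
  side-inj₂ b with any? (λ a → φ (inj₁ a) ≟ φ (inj₂ b)) | any? (λ b′ → φ (inj₂ b′) ≟ φ (inj₂ b))
  ... | yes (a , e) | _ = contradiction e (φ-disjoint a b)
  ... | no _ | yes _ = refl
  ... | no _ | no ∉V₂ = contradiction (b , refl) ∉V₂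

  side≡0F : ∀ {x} → side x ≡ 0F → ∃ λ a → φ (inj₁ a) ≡ x
  side≡0F {x} with any? (λ a → φ (inj₁ a) ≟ x) | any? (λ b → φ (inj₂ b) ≟ x)
  ... | yes ∈V₁ | _ = λ _ → ∈V₁
  ... | no _ | yes _ = λ ()
  ... | no _ | no _ = λ ()

  side≡1F : ∀ {x} → side x ≡ 1F → ∃ λ b → φ (inj₂ b) ≡ x
  side≡1F {x} with any? (λ a → φ (inj₁ a) ≟ x) | any? (λ b → φ (inj₂ b) ≟ x)
  ... | yes _ | _ = λ ()
  ... | no _ | yes ∈V₂ = λ _ → ∈V₂
  ... | no _ | no _ = λ ()

  classSize-0F : classSize side 0F ≡ s
  classSize-0F = enumeration-length V₁ (λ x → side x ≟ 0F)
    where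
      V₁ : Enumeration (λ x → side x ≡ 0F) s
      V₁ = record { index = φ ∘ inj₁ ; injective = inj₁-injective ∘ φ-injective
                  ; sound = side-inj₁ ; exhaustive = side≡0F }

  classSize-1F : classSize side 1F ≡ t
  classSize-1F = enumeration-length V₂ (λ x → side x ≟ 1F)
    where
      V₂ : Enumeration (λ x → side x ≡ 1F) t
      V₂ = record { index = φ ∘ inj₂ ; injective = inj₂-injective ∘ φ-injective
                  ; sound = side-inj₂ ; exhaustive = side≡1F }

  classSize-2F : classSize side 2F ≡ 1
  classSize-2F = +-cancelˡ-≡ (s + t) _ 1 (begin
      s + t + classSize side 2F
    ≡⟨ cong₂ (λ p q → p + q + classSize side 2F) (sym classSize-0F) (sym classSize-1F) ⟩
      classSize side 0F + classSize side 1F + classSize side 2F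
    ≡⟨ classSize-total side ⟩
      suc (s + t)
    ≡⟨ +-comm 1 (s + t) ⟩
      s + t + 1 ∎)
    where open ≡-Reasoning

copy⇒erasableEdge : ∀ {s t} {G H : Graph (suc (s + t))} {u v} → IsComplement G H →
                    (c : Copy s t (addEdge H u v)) → CopyContains c u v → ErasableEdge s t G u v
copy⇒erasableEdge {s} {t} {G} {H} {u} {v} comp c (a , b , uv∈c) =
  side , classSize-0F , classSize-1F , classSize-2F , uv-crosses uv∈c , only-uv
  where
    open Copy c
    open CopyPartition φ inj

    in-V₁ : ∀ {x} → φ (inj₁ a) ≡ x → side x ≡ 0F
    in-V₁ refl = side-inj₁ a

    in-V₂ : ∀ {y} → φ (inj₂ b) ≡ y → side y ≡ 1F
    in-V₂ refl = side-inj₂ b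

    uv-crosses : (φ (inj₁ a) ≡ u × φ (inj₂ b) ≡ v) ⊎ (φ (inj₁ a) ≡ v × φ (inj₂ b) ≡ u) →
                 (side u ≡ 0F × side v ≡ 1F) ⊎ (side v ≡ 0F × side u ≡ 1F)
    uv-crosses (inj₁ (ea , eb)) = inj₁ (in-V₁ ea , in-V₂ eb)
    uv-crosses (inj₂ (ea , eb)) = inj₂ (in-V₁ ea , in-V₂ eb)

    only-uv : ∀ x y → side x ≡ 0F → side y ≡ 1F → adj G x y ≡ true → sameEdge u v x y ≡ true
    only-uv x y x∈V₁ y∈V₂ gxy with side≡0F x∈V₁ | side≡1F y∈V₂
    ... | a′ , refl | b′ , refl =
      subst (λ h → h ∨ sameEdge u v x y ≡ true) (trans (adj-complement comp x≢y) (cong not gxy))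
            (trans (sym (addEdge-adj H u v x≢y)) (edges a′ b′))
      where x≢y = φ-disjoint a′ b′

erasableEdge⇒copy : ∀ {s t} {G H : Graph (suc (s + t))} {u v} → IsComplement G H →
                    ErasableEdge s t G u v → Σ (Copy s t (addEdge H u v)) (λ c → CopyContains c u v)
erasableEdge⇒copy {s} {t} {G} {H} {u} {v} comp (part , |V₁|≡s , |V₂|≡t , _ , uv-crosses , only-uv) =
  copy , copy-contains uv-crosses
  where
    module V₁ = Enumeration (enumerate (λ x → part x ≟ 0F) |V₁|≡s)
    module V₂ = Enumeration (enumerate (λ x → part x ≟ 1F) |V₂|≡t)

    V₁≢V₂ : ∀ a b → V₁.index a ≢ V₂.index b
    V₁≢V₂ a b e with () ← trans (sym (V₁.sound a)) (trans (cong part e) (V₂.sound b))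

    φ : Fin s ⊎ Fin t → Fin (suc (s + t))
    φ = [ V₁.index , V₂.index ]

    φ-injective : Injective _≡_ _≡_ φ
    φ-injective {inj₁ a} {inj₁ a′} e = cong inj₁ (V₁.injective e)
    φ-injective {inj₁ a} {inj₂ b} e = contradiction e (V₁≢V₂ a b)
    φ-injective {inj₂ b} {inj₁ a} e = contradiction (sym e) (V₁≢V₂ a b)
    φ-injective {inj₂ b} {inj₂ b′} e = cong inj₂ (V₂.injective e)

    crossing-edge : ∀ a b → adj (addEdge H u v) (V₁.index a) (V₂.index b) ≡ true
    crossing-edge a b = begin
        adj (addEdge H u v) x y          ≡⟨ addEdge-adj H u v (V₁≢V₂ a b) ⟩
        adj H x y ∨ sameEdge u v x y     ≡⟨ cong (_∨ sameEdge u v x y) (adj-complement comp (V₁≢V₂ a b)) ⟩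
        not (adj G x y) ∨ sameEdge u v x y ≡⟨ ⇒-as-∨ (only-uv x y (V₁.sound a) (V₂.sound b)) ⟩
        true                             ∎
      where
        open ≡-Reasoning
        x = V₁.index a
        y = V₂.index b

    copy : Copy s t (addEdge H u v)
    copy = record { φ = φ ; inj = φ-injective ; edges = crossing-edge }

    copy-contains : (part u ≡ 0F × part v ≡ 1F) ⊎ (part v ≡ 0F × part u ≡ 1F) → CopyContains copy u v
    copy-contains (inj₁ (u∈V₁ , v∈V₂)) with V₁.exhaustive u∈V₁ | V₂.exhaustive v∈V₂
    ... | a , ea | b , eb = a , b , inj₁ (ea , eb)
    copy-contains (inj₂ (v∈V₁ , u∈V₂)) with V₁.exhaustive v∈V₁ | V₂.exhaustive u∈V₂
    ... | a , ea | b , eb = a , b , inj₂ (ea , eb)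

erasable⇒completes : ∀ {s t} {G H : Graph (suc (s + t))} → IsComplement G H → Erasable s t G → Completes s t H
erasable⇒completes comp (done empty) =
  complete λ i j i≢j → trans (adj-complement comp i≢j) (cong not (empty i j))
erasable⇒completes {G = G} {H} comp (erase u v guv uv-erasable rest) =
  add u v u≢v huv (erasableEdge⇒copy comp uv-erasable) (erasable⇒completes (isComplement-removeEdge comp) rest)
  where
    u≢v = adj⇒≢ G guv
    huv : adj H u v ≡ false
    huv = trans (adj-complement comp u≢v) (cong not guv)

completes⇒erasable : ∀ {s t} {G H : Graph (suc (s + t))} → IsComplement G H → Completes s t H → Erasable s t G
completes⇒erasable {G = G} comp (complete full) =
  done (edgeless G λ i≢j → trans (adj-complement (isComplement-sym comp) i≢j) (cong not (full _ _ i≢j)))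
completes⇒erasable comp (add u v u≢v huv (c , uv∈c) rest) =
  erase u v guv (copy⇒erasableEdge comp c uv∈c) (completes⇒erasable (isComplement-removeEdge comp) rest)
  where
    guv = trans (adj-complement (isComplement-sym comp) u≢v) (cong not huv)

addEdge-erasable : ∀ {s t} {G H : Graph (suc (s + t))} → IsComplement G H → Erasable s t G →
                   (c : Copy s t H) → ∀ a b →
                   Erasable s t (addEdge G (Copy.φ c (inj₁ a)) (Copy.φ c (inj₂ b)))
addEdge-erasable {s} {t} {G} {H} comp erasable c a b =
  completes⇒erasable (isComplement-addEdge comp) H′-completes
  where
    open Copy c
    x = φ (inj₁ a)
    y = φ (inj₂ b)
    H′ = removeEdge H x y
    restored : ∀ i j → adj (addEdge H′ x y) i j ≡ adj H i j
    restored = addEdge-removeEdge H (edges a b)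
    restored-isComplement : IsComplement G (addEdge H′ x y)
    restored-isComplement .adj-complement {i} {j} i≢j = trans (restored i j) (adj-complement comp i≢j)
    H′-completes : Completes s t H′
    H′-completes =
      add x y (λ e → contradiction (inj e) λ ()) (removeEdge-adj-self H x y)
          (copy-⊆ (λ i j → trans (restored i j)) c , a , b , inj₁ (refl , refl))
          (erasable⇒completes restored-isComplement erasable)

MaximumErasable : (s t : ℕ) → Graph (suc (s + t)) → Set
MaximumErasable s t G = (G′ : Graph (suc (s + t))) → Erasable s t G′ → edgeCount G′ ≤ edgeCount G

maximum⇒complement-Copy-free : ∀ {s t} {G : Graph (suc (s + t))} → 1 ≤ s → 1 ≤ t →
                               Erasable s t G → MaximumErasable s t G → ¬ Copy s t (complement G)
maximum⇒complement-Copy-free {G = G} 1≤s 1≤t erasable maximum c =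
  <⇒≱ more-edges (maximum _ (addEdge-erasable (complement-isComplement G) erasable c a b))
  where
    open Copy c
    a = fromℕ< 1≤s
    b = fromℕ< 1≤t
    x = φ (inj₁ a)
    y = φ (inj₂ b)
    x≢y : x ≢ y
    x≢y e = contradiction (inj e) λ ()
    gxy : adj G x y ≡ false
    gxy = not-injective (trans (sym (adj-complement (complement-isComplement G) x≢y)) (edges a b))
    more-edges : edgeCount G < edgeCount (addEdge G x y)
    more-edges = edgeCount-< G (addEdge G x y) (addEdge-⊇ G x y) x y gxy (addEdge-adj-self G x≢y)

maximum⇒complement-minimum : ∀ {s t} {G : Graph (suc (s + t))} → MaximumErasable s t G →
                             (H : Graph (suc (s + t))) → WeaklySat s t H → edgeCount (complement G) ≤ edgeCount H
maximum⇒complement-minimum {s} {t} {G} maximum H (_ , H-completes) = begin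
    edgeCount (complement G)
  ≡⟨ isComplement⇒edgeCount (complement-isComplement G) ⟩
    suc (s + t) C 2 ∸ edgeCount G
  ≤⟨ ∸-monoʳ-≤ (suc (s + t) C 2) (maximum (complement H) (completes⇒erasable Hᶜ-H H-completes)) ⟩
    suc (s + t) C 2 ∸ edgeCount (complement H)
  ≡⟨ isComplement⇒edgeCount Hᶜ-H ⟨
    edgeCount H ∎
  where
    open ≤-Reasoning
    Hᶜ-H : IsComplement (complement H) H
    Hᶜ-H = isComplement-sym (complement-isComplement H)

claim1 : (s t : ℕ) → 1 ≤ s → 1 ≤ t →
         (G : Graph (suc (s + t))) → Erasable s t G →
         ((G′ : Graph (suc (s + t))) → Erasable s t G′ → edgeCount G′ ≤ edgeCount G) →
         Σ ℕ (λ w → IsWsat (suc (s + t)) s t w ×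
                    edgeCount G ≡ (suc (s + t) C 2) ∸ w)
claim1 s t 1≤s 1≤t G erasable maximum =
  edgeCount H ,
  ((H , (maximum⇒complement-Copy-free 1≤s 1≤t erasable maximum , erasable⇒completes G-H erasable) , refl) ,
   maximum⇒complement-minimum {G = G} maximum) ,
  isComplement⇒edgeCount (isComplement-sym G-H)
  where
    H = complement G
    G-H = complement-isComplement G
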